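{- Let $\Gamma$ be a connected $3$-regular bipartite graph on $n$ vertices. Then $\dim_M(\Gamma)\geq 3$.
   Context: For a simple connected graph $\Gamma$ and vertices $x,y$, $d(x,y)$ denotes the length of a shortest path between them. For an ordered set $W=\{w_1,\dots,w_k\}$ of vertices and a vertex $v$, $r(v\mid W)=(d(v,w_1),\dots,d(v,w_k))$. $W$ is a resolving set if distinct vertices have distinct representations $r(\cdot\mid W)$. The metric dimension $\dim_M(\Gamma)$ is the minimum cardinality of a resolving set. -}

module Defs where

open import Data.Nat using (ℕ; zero; suc; _<_)
open import Data.Fin using (Fin)
open import Data.Bool using (Bool; true; false; T; not)
open import Data.Vec using (allFin; count)
open import Data.List using (List)
open import Data.List.Membership.Propositional using (_∈_)
open import Data.Product using (Σ; ∃; _×_)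
open import Relation.Binary.PropositionalEquality using (_≡_; _≢_)
open import Relation.Nullary using (¬_)
open import Relation.Nullary.Decidable using (does)
open import Function.Bundles using (_⇔_)
open import Data.Fin using (_≟_)

record Graph (n : ℕ) : Set where
  field
    adj     : Fin n → Fin n → Bool
    sym     : ∀ x y → adj x y ≡ adj y x
    loopless : ∀ x → adj x x ≡ false
open Graph public

Adj : ∀ {n} → Graph n → Fin n → Fin n → Set
Adj G x y = T (adj G x y)

data Walk {n} (G : Graph n) : Fin n → Fin n → ℕ → Set where
  here : ∀ x → Walk G x x zero
  step : ∀ {x y z k} → Adj G x y → Walk G y z k → Walk G x z (suc k)

Dist : ∀ {n} → Graph n → Fin n → Fin n → ℕ → Set
Dist G x y k = Walk G x y k × (∀ m → m < k → ¬ Walk G x y m)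

-- connected graphs are nonempty by convention
Connected : ∀ {n} → Graph n → Set
Connected {n} G = (0 < n) × (∀ x y → ∃ λ k → Walk G x y k)

degree : ∀ {n} → Graph n → Fin n → ℕ
degree {n} G x = count (λ y → T? (adj G x y)) (allFin n)
  where
  open import Data.Bool.Properties using (T?)

Regular : ∀ {n} → ℕ → Graph n → Set
Regular r G = ∀ x → degree G x ≡ r

Bipartite : ∀ {n} → Graph n → Set
Bipartite {n} G = Σ (Fin n → Bool) λ c → ∀ x y → Adj G x y → c x ≢ c y

Resolving : ∀ {n} → Graph n → List (Fin n) → Set
Resolving G W = ∀ u v → (∀ w → w ∈ W → ∀ k → Dist G u w k ⇔ Dist G v w k) → u ≡ v

-- Fix w₁, w₂ and let D = d(w₁, w₂). Each of the three neighbours u of w₁ is at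
-- distance 1 from w₁, and at distance D ± 1 from w₂: the triangle inequality
-- gives |d(u, w₂) − D| ≤ 1, and bipartiteness rules out d(u, w₂) = D, since two
-- walks of equal length to w₂ cannot start at vertices of different colours.
-- By pigeonhole two of the three neighbours have the same distances to w₁ and
-- to w₂, so no set of at most two vertices is resolving.
module Submission where

open import Defs hiding (sym)
open import Data.Nat using (ℕ; zero; suc; pred; _≤_; _<_; z≤n; s≤s)
open import Data.Nat.Properties
  using (<-cmp; ≤-refl; ≤-antisym; ≮⇒≥; anyUpTo?)
open import Data.Nat.Induction using (<-rec)
open import Data.Fin using (Fin; zero; suc; fromℕ<; _≟_)
open import Data.Fin.Properties using (any?)
open import Data.Bool using (Bool; true; false; T; not)
open import Data.Bool.Properties using (T?; not-injective; ¬-not)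
open import Data.Vec using (count) renaming (tabulate to tabulateᵛ)
open import Data.List using (List; []; _∷_; length; filter; tabulate; allFin)
open import Data.List.Membership.Propositional using (_∈_)
open import Data.List.Membership.Propositional.Properties using (∈-filter⁻)
open import Data.List.Relation.Unary.Any using (here; there)
open import Data.List.Relation.Unary.AllPairs using (_∷_)
open import Data.List.Relation.Unary.All using (_∷_)
open import Data.List.Relation.Unary.Unique.Propositional using (Unique)
open import Data.List.Relation.Unary.Unique.Propositional.Properties using (allFin⁺; filter⁺)
open import Data.List.Relation.Binary.Subset.Propositional using (_⊆_)
open import Data.Empty using (⊥-elim)
open import Data.Product using (∃; ∃₂; _×_; _,_; proj₁; proj₂)
open import Data.Sum using (_⊎_; inj₁; inj₂)
open import Relation.Binary.Definitions using (tri<; tri≈; tri>)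
open import Relation.Binary.PropositionalEquality using (_≡_; _≢_; refl; sym; trans; cong; subst)
open import Relation.Nullary using (¬_; Dec; yes; no; does)
open import Relation.Nullary.Decidable using (_×-dec_)
open import Relation.Unary using (Pred; Decidable)
open import Function.Bundles using (_⇔_; mk⇔)

Least : ∀ {p} → Pred ℕ p → Pred ℕ p
Least P m = P m × (∀ j → j < m → ¬ P j)

least-witness : ∀ {p} {P : Pred ℕ p} → Decidable P → ∀ {k} → P k → ∃ (Least P)
least-witness {P = P} P? {k} = <-rec (λ k → P k → ∃ (Least P)) search k
  where
  search : ∀ k → (∀ {j} → j < k → P j → ∃ (Least P)) → P k → ∃ (Least P)
  search k smaller pk with anyUpTo? P? k
  ... | yes (j , j<k , pj) = smaller j<k pj
  ... | no none            = k , pk , λ j j<k pj → none (j , j<k , pj)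

≤suc-both-ways : ∀ {m n} → m ≤ suc n → n ≤ suc m → m ≢ n → m ≡ suc n ⊎ m ≡ pred n
≤suc-both-ways {m} {n} m≤1+n n≤1+m m≢n with <-cmp m n
... | tri< m<n _ _ = inj₂ (cong pred (sym (≤-antisym n≤1+m m<n)))
... | tri≈ _ m≡n _ = ⊥-elim (m≢n m≡n)
... | tri> _ _ n<m = inj₁ (≤-antisym m≤1+n n<m)

two-of-three : ∀ {a} {A : Set a} {x y p q r : A} →
  p ≡ x ⊎ p ≡ y → q ≡ x ⊎ q ≡ y → r ≡ x ⊎ r ≡ y → p ≡ q ⊎ p ≡ r ⊎ q ≡ r
two-of-three (inj₁ refl) (inj₁ refl) _           = inj₁ refl
two-of-three (inj₂ refl) (inj₂ refl) _           = inj₁ refl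
two-of-three (inj₁ refl) (inj₂ refl) (inj₁ refl) = inj₂ (inj₁ refl)
two-of-three (inj₁ refl) (inj₂ refl) (inj₂ refl) = inj₂ (inj₂ refl)
two-of-three (inj₂ refl) (inj₁ refl) (inj₁ refl) = inj₂ (inj₂ refl)
two-of-three (inj₂ refl) (inj₁ refl) (inj₂ refl) = inj₂ (inj₁ refl)

pigeonhole-two-values : ∀ {a b} {A : Set a} {B : Set b} {xs : List A} {y₁ y₂ : B} (f : A → B) →
  Unique xs → 3 ≤ length xs → (∀ {x} → x ∈ xs → f x ≡ y₁ ⊎ f x ≡ y₂) →
  ∃₂ λ x x′ → x ≢ x′ × x ∈ xs × x′ ∈ xs × f x ≡ f x′
pigeonhole-two-values {xs = []}        f _ () _
pigeonhole-two-values {xs = _ ∷ []}    f _ (s≤s ()) _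
pigeonhole-two-values {xs = _ ∷ _ ∷ []} f _ (s≤s (s≤s ())) _
pigeonhole-two-values {xs = p ∷ q ∷ r ∷ _} f ((p≢q ∷ p≢r ∷ _) ∷ (q≢r ∷ _) ∷ _) _ two-values
  with two-of-three (two-values (here refl)) (two-values (there (here refl)))
                    (two-values (there (there (here refl))))
... | inj₁ fp≡fq        = p , q , p≢q , here refl , there (here refl) , fp≡fq
... | inj₂ (inj₁ fp≡fr) = p , r , p≢r , here refl , there (there (here refl)) , fp≡fr
... | inj₂ (inj₂ fq≡fr) = q , r , q≢r , there (here refl) , there (there (here refl)) , fq≡fr

count-tabulate : ∀ {a p} {A : Set a} {P : Pred A p} (P? : Decidable P) {n} (f : Fin n → A) →
  count P? (tabulateᵛ f) ≡ length (filter P? (tabulate f))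
count-tabulate P? {zero} f = refl
count-tabulate P? {suc n} f with does (P? (f zero))
... | true  = cong suc (count-tabulate P? (λ i → f (suc i)))
... | false = count-tabulate P? (λ i → f (suc i))

module _ {n : ℕ} (G : Graph n) where

  Adj-sym : ∀ {x y} → Adj G x y → Adj G y x
  Adj-sym {x} {y} = subst T (Graph.sym G x y)

  Adj⇒≢ : ∀ {x y} → Adj G x y → x ≢ y
  Adj⇒≢ {x} xy refl = subst T (loopless G x) xy

  Walk-zero⇒≡ : ∀ {x y} → Walk G x y 0 → x ≡ y
  Walk-zero⇒≡ (here _) = refl

  walk? : ∀ x y k → Dec (Walk G x y k)
  walk? x y zero with x ≟ y
  ... | yes refl = yes (here x)
  ... | no x≢y   = no λ w → x≢y (Walk-zero⇒≡ w)
  walk? x z (suc k) with any? (λ y → T? (adj G x y) ×-dec walk? y z k)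
  ... | yes (y , xy , w) = yes (step xy w)
  ... | no none          = no λ { (step {y = y} xy w) → none (y , xy , w) }

  Walk⇒Dist : ∀ {x y k} → Walk G x y k → ∃ (Dist G x y)
  Walk⇒Dist {x} {y} = least-witness (walk? x y)

  Dist-unique : ∀ {x y a b} → Dist G x y a → Dist G x y b → a ≡ b
  Dist-unique {a = a} {b} (wa , a-least) (wb , b-least) with <-cmp a b
  ... | tri< a<b _ _ = ⊥-elim (b-least a a<b wa)
  ... | tri≈ _ a≡b _ = a≡b
  ... | tri> _ _ b<a = ⊥-elim (a-least b b<a wb)

  Adj⇒Dist-one : ∀ {x y} → Adj G x y → Dist G x y 1
  Adj⇒Dist-one {x} {y} xy = step xy (here y) , λ
    { zero _ w → Adj⇒≢ xy (Walk-zero⇒≡ w)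
    ; (suc _) (s≤s ()) }

  Dist-step-≤ : ∀ {x y z a b} → Adj G x y → Dist G x z a → Dist G y z b → a ≤ suc b
  Dist-step-≤ {b = b} xy (_ , a-least) (wb , _) = ≮⇒≥ λ 1+b<a → a-least (suc b) 1+b<a (step xy wb)

  neighbours : Fin n → List (Fin n)
  neighbours x = filter (λ y → T? (adj G x y)) (allFin n)

  length-neighbours : ∀ x → length (neighbours x) ≡ degree G x
  length-neighbours x = sym (count-tabulate (λ y → T? (adj G x y)) (λ y → y))

  neighbours-unique : ∀ x → Unique (neighbours x)
  neighbours-unique x = filter⁺ (λ y → T? (adj G x y)) (allFin⁺ n)

  ∈-neighbours⇒Adj : ∀ {x y} → y ∈ neighbours x → Adj G x y
  ∈-neighbours⇒Adj {x} y∈ = proj₂ (∈-filter⁻ (λ y → T? (adj G x y)) {xs = allFin n} y∈)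

flips : ℕ → Bool → Bool
flips zero    b = b
flips (suc k) b = flips k (not b)

flips-injective : ∀ k {a b} → flips k a ≡ flips k b → a ≡ b
flips-injective zero    a≡b = a≡b
flips-injective (suc k) e   = not-injective (flips-injective k e)

module _ {n : ℕ} (G : Graph n) (c : Fin n → Bool) (proper : ∀ x y → Adj G x y → c x ≢ c y) where

  Walk-colour : ∀ {x y k} → Walk G x y k → c y ≡ flips k (c x)
  Walk-colour (here _) = refl
  Walk-colour {x} (step {y = y} {k = k} xy w) =
    trans (Walk-colour w) (cong (flips k) (¬-not (proper y x (Adj-sym G xy))))

  equal-length-Walks⇒same-colour : ∀ {x y z k} → Walk G x z k → Walk G y z k → c x ≡ c y
  equal-length-Walks⇒same-colour {k = k} p q =
    flips-injective k (trans (sym (Walk-colour p)) (Walk-colour q))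

  Adj⇒¬equal-length-Walks : ∀ {x y z k} → Adj G x y → Walk G x z k → ¬ Walk G y z k
  Adj⇒¬equal-length-Walks {x} {y} xy p q = proper x y xy (equal-length-Walks⇒same-colour p q)

module _ {n : ℕ} (G : Graph n) (con : Connected G) where

  d : Fin n → Fin n → ℕ
  d x y = proj₁ (Walk⇒Dist G (proj₂ (proj₂ con x y)))

  Dist-d : ∀ x y → Dist G x y (d x y)
  Dist-d x y = proj₂ (Walk⇒Dist G (proj₂ (proj₂ con x y)))

  d-Adj : ∀ {x y} → Adj G x y → d x y ≡ 1
  d-Adj {x} {y} xy = Dist-unique G (Dist-d x y) (Adj⇒Dist-one G xy)

  ≡-d⇒Dist-⇔ : ∀ {u v w} → d u w ≡ d v w → ∀ k → Dist G u w k ⇔ Dist G v w k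
  ≡-d⇒Dist-⇔ {u} {v} {w} du≡dv k = mk⇔
    (λ du → subst (Dist G v w) (trans (sym du≡dv) (Dist-unique G (Dist-d u w) du)) (Dist-d v w))
    (λ dv → subst (Dist G u w) (trans du≡dv (Dist-unique G (Dist-d v w) dv)) (Dist-d u w))

  d-Adj-bipartite : Bipartite G → ∀ {x y z} → Adj G x y → d y z ≡ suc (d x z) ⊎ d y z ≡ pred (d x z)
  d-Adj-bipartite (c , proper) {x} {y} {z} xy = ≤suc-both-ways
    (Dist-step-≤ G (Adj-sym G xy) (Dist-d y z) (Dist-d x z))
    (Dist-step-≤ G xy (Dist-d x z) (Dist-d y z))
    λ dy≡dx → Adj⇒¬equal-length-Walks G c proper xy
      (proj₁ (Dist-d x z)) (subst (Walk G y z) dy≡dx (proj₁ (Dist-d y z)))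

  module _ (cubic : Regular 3 G) (bip : Bipartite G) where

    twin-neighbours : ∀ w₁ w₂ → ∃₂ λ u v → u ≢ v × d u w₁ ≡ d v w₁ × d u w₂ ≡ d v w₂
    twin-neighbours w₁ w₂ with pigeonhole-two-values (λ u → d u w₂) (neighbours-unique G w₁)
      (subst (3 ≤_) (sym (trans (length-neighbours G w₁) (cubic w₁))) ≤-refl)
      (λ u∈ → d-Adj-bipartite bip (∈-neighbours⇒Adj G u∈))
    ... | u , v , u≢v , u∈ , v∈ , du≡dv = u , v , u≢v , trans (d-to-w₁ u∈) (sym (d-to-w₁ v∈)) , du≡dv
      where
      d-to-w₁ : ∀ {u} → u ∈ neighbours G w₁ → d u w₁ ≡ 1
      d-to-w₁ u∈ = d-Adj (Adj-sym G (∈-neighbours⇒Adj G u∈))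

    ⊆-pair⇒¬Resolving : ∀ {W} w₁ w₂ → W ⊆ w₁ ∷ w₂ ∷ [] → ¬ Resolving G W
    ⊆-pair⇒¬Resolving w₁ w₂ W⊆ resolving with twin-neighbours w₁ w₂
    ... | u , v , u≢v , d₁ , d₂ = u≢v (resolving u v λ w w∈ → agree (W⊆ w∈))
      where
      agree : ∀ {w} → w ∈ w₁ ∷ w₂ ∷ [] → ∀ k → Dist G u w k ⇔ Dist G v w k
      agree (here refl)         = ≡-d⇒Dist-⇔ d₁
      agree (there (here refl)) = ≡-d⇒Dist-⇔ d₂

mainTheorem3 : (n : ℕ) (G : Graph n) → Connected G → Regular 3 G → Bipartite G →
    (W : List (Fin n)) → Unique W → Resolving G W → 3 ≤ length W
mainTheorem3 n G con cubic bip [] _ resolving =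
  ⊥-elim (⊆-pair⇒¬Resolving G con cubic bip v v (λ ()) resolving)
  where
  v : Fin n
  v = fromℕ< (proj₁ con)
mainTheorem3 n G con cubic bip (w ∷ []) _ resolving =
  ⊥-elim (⊆-pair⇒¬Resolving G con cubic bip w w (λ { (here refl) → here refl }) resolving)
mainTheorem3 n G con cubic bip (w₁ ∷ w₂ ∷ []) _ resolving =
  ⊥-elim (⊆-pair⇒¬Resolving G con cubic bip w₁ w₂ (λ w∈ → w∈) resolving)
mainTheorem3 n G con cubic bip (_ ∷ _ ∷ _ ∷ _) _ _ = s≤s (s≤s (s≤s z≤n))
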